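{- Let $N$ be a weakly reversible chemical reaction network. Then no vertex of $\mathcal H_N$ is almost balanced.
   Context: A chemical reaction network $N=(\mathscr S,\mathscr C,\mathscr R)$ consists of a finite set of species $\mathscr S$, complexes $\mathscr C\subseteq\mathbb Z_{\ge0}^{\mathscr S}$, and reactions $y\to y'$ with $y\ne y'$; every complex occurs in some reaction, every species lies in some complex's support, and there are no reactions $\varnothing\to y$. $N$ is weakly reversible if for any complexes $y,y'$, whenever there is a directed path of reactions from $y$ to $y'$ there is also a directed path of reactions from $y'$ to $y$. Reactions are indexed $1,\dots,m$, the $i$-th written $y_i\to y_i'$. The network hypergraph $\mathcal H_N$ has $2m$ vertices $u_1,v_1,\dots,u_m,v_m$ ($u_i$ corresponds to the reactant $y_i$ of reaction $i$, $v_i$ to its product $y_i'$). Hyperedges: for each species $s$, $E_s=\{u_i: s\in\mathrm{supp}(y_i)\}\cup\{v_i: s\in\mathrm{supp}(y_i')\}$; for each reaction $i$, $E_i=\{u_i,v_i\}$ if $y_i'\ne\varnothing$ and $E_i=\varnothing$ otherwise. A vertex $w$ is almost balanced if there is a multiset $\mathscr E$ of edges (nonnegative multiplicities) and a splitting $\mathscr E=\mathscr E_r\sqcup\mathscr E_b$ into two submultisets whose multiplicities add up, such that, writing $\deg_{\mathscr E_c}(z)$ for the number of edges of $\mathscr E_c$ (with multiplicity) containing $z$, $\deg_{\mathscr E_r}(w)=\deg_{\mathscr E_b}(w)+k$ for some positive integer $k$ and $\deg_{\mathscr E_r}(z)=\deg_{\mathscr E_b}(z)$ for every other vertex $z$.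 -}

module Defs where

open import Data.Nat using (ℕ; zero; suc; _+_; _*_; _<_)
open import Data.Fin using (Fin; zero; suc; _≟_)
open import Data.Vec using (Vec; lookup; replicate)
open import Data.Sum using (_⊎_; inj₁; inj₂)
open import Data.Product using (Σ; ∃; ∃-syntax; _×_; _,_)
open import Data.Bool using (Bool; true; false; _∧_)
open import Relation.Nullary using (¬_)
open import Relation.Nullary.Decidable using (⌊_⌋)
open import Relation.Binary.PropositionalEquality using (_≡_; _≢_)
open import Relation.Binary.Construct.Closure.ReflexiveTransitive using (Star)

-- Complexes are vectors in ℕ^n (Vec ℕ n); the i-th reaction is
-- reactant i → product i.  The set of complexes is the set of all
-- reactants and products (every complex occurs in some reaction).
record Network (n m : ℕ) : Set where
  field
    reactant : Fin m → Vec ℕ n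
    product  : Fin m → Vec ℕ n
open Network public

zeroComplex : (n : ℕ) → Vec ℕ n
zeroComplex n = replicate n 0

record IsCRN {n m : ℕ} (N : Network n m) : Set where
  field
    nonTrivial : ∀ i → reactant N i ≢ product N i
    -- reactions form a set: distinct indices are distinct reactions
    distinct   : ∀ i j → reactant N i ≡ reactant N j → product N i ≡ product N j → i ≡ j
    speciesUsed : ∀ (s : Fin n) → ∃[ i ] (lookup (reactant N i) s ≢ 0 ⊎ lookup (product N i) s ≢ 0)
    noInflow   : ∀ i → reactant N i ≢ zeroComplex n

Step : ∀ {n m} → Network n m → Vec ℕ n → Vec ℕ n → Set
Step N c c' = ∃[ i ] (reactant N i ≡ c × product N i ≡ c')

Path : ∀ {n m} → Network n m → Vec ℕ n → Vec ℕ n → Set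
Path N = Star (Step N)

WeaklyReversible : ∀ {n m} → Network n m → Set
WeaklyReversible {n} N = ∀ (c c' : Vec ℕ n) → Path N c c' → Path N c' c

-- The network hypergraph H_N

-- vertices u_i (reactant of reaction i) and v_i (product of reaction i)
data Vertex (m : ℕ) : Set where
  u : Fin m → Vertex m
  v : Fin m → Vertex m

-- edge labels: E_s for species s (inj₁ s), E_i for reaction i (inj₂ i)
Edge : ℕ → ℕ → Set
Edge n m = Fin n ⊎ Fin m

nonzero : ℕ → Bool
nonzero zero    = false
nonzero (suc _) = true

nonempty : ∀ {n} → Vec ℕ n → Bool
nonempty Vec.[] = false
nonempty (x Vec.∷ xs) with nonzero x
... | true  = true
... | false = nonempty xs

_∈E_ : ∀ {n m} {N : Network n m} → Vertex m → Edge n m → Bool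
_∈E_ {N = N} (u i) (inj₁ s) = nonzero (lookup (reactant N i) s)
_∈E_ {N = N} (v i) (inj₁ s) = nonzero (lookup (product N i) s)
_∈E_ {N = N} (u j) (inj₂ i) = ⌊ j ≟ i ⌋ ∧ nonempty (product N i)
_∈E_ {N = N} (v j) (inj₂ i) = ⌊ j ≟ i ⌋ ∧ nonempty (product N i)

mem : ∀ {n m} (N : Network n m) → Vertex m → Edge n m → ℕ
mem N z e with _∈E_ {N = N} z e
... | true  = 1
... | false = 0

sumFin : ∀ {k} → (Fin k → ℕ) → ℕ
sumFin {zero}  f = 0
sumFin {suc k} f = f zero + sumFin (λ i → f (suc i))

-- a multiset of edges is a multiplicity function Edge n m → ℕ;
-- degree of vertex z in that multiset (counted with multiplicity)
deg : ∀ {n m} (N : Network n m) → (Edge n m → ℕ) → Vertex m → ℕ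
deg N μ z = sumFin (λ s → μ (inj₁ s) * mem N z (inj₁ s))
          + sumFin (λ i → μ (inj₂ i) * mem N z (inj₂ i))

-- w is almost balanced: there is a multiset of edges split into a red part
-- μr and a blue part μb (multiplicities add up to those of E = μr + μb)
-- with deg_r(w) = deg_b(w) + k for some k > 0 and deg_r(z) = deg_b(z) else.
AlmostBalanced : ∀ {n m} (N : Network n m) → Vertex m → Set
AlmostBalanced {n} {m} N w =
  Σ (Edge n m → ℕ) λ μr → Σ (Edge n m → ℕ) λ μb → Σ ℕ λ k →
    0 < k
    × deg N μr w ≡ deg N μb w + k
    × (∀ (z : Vertex m) → z ≢ w → deg N μr z ≡ deg N μb z)

-- A cycle through the reaction i of w (weak reversibility provides one) uses
-- each reaction j some number x_j of times, with x_i > 0, and enters every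
-- complex as often as it leaves it.  Hence for every multiset of edges the
-- weighted degree sums Σ_j x_j deg(u_j) and Σ_j x_j deg(v_j) coincide.  For a
-- splitting almost balanced at w, red and blue weighted sums agree on the side
-- opposite to w but differ by x_i k > 0 on the side of w.
module Submission where

open import Defs
open import Data.Nat using (ℕ; zero; suc; _+_; _*_; _≤_; _<_)
open import Data.Nat.Properties
  using ( +-assoc; +-comm; +-cancelʳ-≡; *-distribˡ-+; *-zeroʳ; ≤-refl; ≤-reflexive
        ; m≤m+n; m<m+n; +-mono-≤; +-mono-<-≤; <-irrefl; +-commutativeSemigroup)
open import Algebra.Properties.CommutativeSemigroup +-commutativeSemigroup using (interchange)
open import Data.Fin using (Fin; zero; suc; _≟_)
open import Data.Vec using (Vec; lookup)
open import Data.Sum using (inj₁; inj₂)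
open import Data.Product using (_,_; proj₁)
open import Data.Bool using (true; false; if_then_else_)
open import Function using (_∘_)
open import Relation.Nullary using (¬_; yes; no)
open import Relation.Nullary.Decidable using (map′)
open import Relation.Binary.Definitions using (DecidableEquality)
open import Relation.Binary.PropositionalEquality
open import Relation.Binary.Construct.Closure.ReflexiveTransitive using (ε; _◅_)

sumFin-cong : ∀ {k} {f g : Fin k → ℕ} → (∀ i → f i ≡ g i) → sumFin f ≡ sumFin g
sumFin-cong {zero}  f≗g = refl
sumFin-cong {suc k} f≗g = cong₂ _+_ (f≗g zero) (sumFin-cong (f≗g ∘ suc))

sumFin-zero : ∀ k → sumFin {k} (λ _ → 0) ≡ 0
sumFin-zero zero    = refl
sumFin-zero (suc k) = sumFin-zero k

sumFin-+ : ∀ {k} (f g : Fin k → ℕ) → sumFin (λ i → f i + g i) ≡ sumFin f + sumFin g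
sumFin-+ {zero}  f g = refl
sumFin-+ {suc k} f g = trans (cong (f zero + g zero +_) (sumFin-+ (f ∘ suc) (g ∘ suc)))
                             (interchange (f zero) (g zero) _ _)

module _ {n m : ℕ} {N : Network n m} where

  sumAlong : ∀ {c c'} → Path N c c' → (Fin m → ℕ) → ℕ
  sumAlong ε              g = 0
  sumAlong ((i , _) ◅ p) g = g i + sumAlong p g

  sumAlong-cong : ∀ {c c'} (p : Path N c c') {g h : Fin m → ℕ} →
                  (∀ j → g j ≡ h j) → sumAlong p g ≡ sumAlong p h
  sumAlong-cong ε              g≗h = refl
  sumAlong-cong ((i , _) ◅ p) g≗h = cong₂ _+_ (g≗h i) (sumAlong-cong p g≗h)

  sumAlong-mono-≤ : ∀ {c c'} (p : Path N c c') {g h : Fin m → ℕ} →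
                    (∀ j → g j ≤ h j) → sumAlong p g ≤ sumAlong p h
  sumAlong-mono-≤ ε              g≤h = ≤-refl
  sumAlong-mono-≤ ((i , _) ◅ p) g≤h = +-mono-≤ (g≤h i) (sumAlong-mono-≤ p g≤h)

  sumAlong-+ : ∀ {c c'} (p : Path N c c') (g h : Fin m → ℕ) →
               sumAlong p (λ j → g j + h j) ≡ sumAlong p g + sumAlong p h
  sumAlong-+ ε              g h = refl
  sumAlong-+ ((i , _) ◅ p) g h = trans (cong (g i + h i +_) (sumAlong-+ p g h))
                                       (interchange (g i) (h i) _ _)

  sumAlong-*ˡ : ∀ {c c'} (p : Path N c c') (a : ℕ) (g : Fin m → ℕ) →
                sumAlong p (λ j → a * g j) ≡ a * sumAlong p g
  sumAlong-*ˡ ε              a g = sym (*-zeroʳ a)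
  sumAlong-*ˡ ((i , _) ◅ p) a g = trans (cong (a * g i +_) (sumAlong-*ˡ p a g))
                                        (sym (*-distribˡ-+ a (g i) _))

  sumAlong-sumFin : ∀ {k c c'} (p : Path N c c') (h : Fin m → Fin k → ℕ) →
                    sumAlong p (λ j → sumFin (h j)) ≡ sumFin (λ s → sumAlong p (λ j → h j s))
  sumAlong-sumFin {k} ε              h = sym (sumFin-zero k)
  sumAlong-sumFin     ((i , _) ◅ p) h = trans (cong (sumFin (h i) +_) (sumAlong-sumFin p h))
                                              (sym (sumFin-+ (h i) _))

  sumAlong-telescope : ∀ (F : Vec ℕ n → ℕ) {c c'} (p : Path N c c') →
    sumAlong p (F ∘ reactant N) + F c' ≡ sumAlong p (F ∘ product N) + F c
  sumAlong-telescope F ε = refl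
  sumAlong-telescope F {c' = c'} ((i , refl , refl) ◅ p) = begin
      F y + R + F c'    ≡⟨ +-assoc (F y) R (F c') ⟩
      F y + (R + F c')  ≡⟨ cong (F y +_) (sumAlong-telescope F p) ⟩
      F y + (P + F y')  ≡⟨ +-comm (F y) _ ⟩
      P + F y' + F y    ≡⟨ cong (_+ F y) (+-comm P (F y')) ⟩
      F y' + P + F y    ∎
    where
    open ≡-Reasoning
    y  = reactant N i
    y' = product N i
    R  = sumAlong p (F ∘ reactant N)
    P  = sumAlong p (F ∘ product N)

  sumAlong-closed : ∀ (F : Vec ℕ n → ℕ) {c} (p : Path N c c) →
    sumAlong p (F ∘ reactant N) ≡ sumAlong p (F ∘ product N)
  sumAlong-closed F p = +-cancelʳ-≡ _ _ _ (sumAlong-telescope F p)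

  sumAlong-<-head : ∀ {c c' c''} (s : Step N c c') (p : Path N c' c'') {g h : Fin m → ℕ} →
                    (∀ j → g j ≤ h j) → g (proj₁ s) < h (proj₁ s) → sumAlong (s ◅ p) g < sumAlong (s ◅ p) h
  sumAlong-<-head s p g≤h gᵢ<hᵢ = +-mono-<-≤ gᵢ<hᵢ (sumAlong-mono-≤ p g≤h)

-- deg N μ z is pairing μ (mem N z) on the nose.
pairing : ∀ {n m} → (Edge n m → ℕ) → (Edge n m → ℕ) → ℕ
pairing μ ν = sumFin (λ s → μ (inj₁ s) * ν (inj₁ s)) + sumFin (λ i → μ (inj₂ i) * ν (inj₂ i))

pairing-congʳ : ∀ {n m} (μ : Edge n m → ℕ) {ν ν' : Edge n m → ℕ} →
                (∀ e → ν e ≡ ν' e) → pairing μ ν ≡ pairing μ ν'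
pairing-congʳ μ ν≗ν' = cong₂ _+_ (sumFin-cong (λ s → cong (μ (inj₁ s) *_) (ν≗ν' (inj₁ s))))
                                 (sumFin-cong (λ i → cong (μ (inj₂ i) *_) (ν≗ν' (inj₂ i))))

module _ {n m : ℕ} {N : Network n m} where

  sumAlong-sumFin-*ˡ : ∀ {k c c'} (p : Path N c c') (a : Fin k → ℕ) (h : Fin m → Fin k → ℕ) →
    sumAlong p (λ j → sumFin (λ s → a s * h j s)) ≡ sumFin (λ s → a s * sumAlong p (λ j → h j s))
  sumAlong-sumFin-*ˡ p a h = trans (sumAlong-sumFin p (λ j s → a s * h j s))
                                   (sumFin-cong (λ s → sumAlong-*ˡ p (a s) (λ j → h j s)))

  sumAlong-pairing : ∀ {c c'} (p : Path N c c') (μ : Edge n m → ℕ) (ν : Fin m → Edge n m → ℕ) →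
    sumAlong p (λ j → pairing μ (ν j)) ≡ pairing μ (λ e → sumAlong p (λ j → ν j e))
  sumAlong-pairing p μ ν = trans (sumAlong-+ p _ _)
    (cong₂ _+_ (sumAlong-sumFin-*ˡ p (μ ∘ inj₁) (λ j → ν j ∘ inj₁))
               (sumAlong-sumFin-*ˡ p (μ ∘ inj₂) (λ j → ν j ∘ inj₂)))

  mem-∈E : ∀ z e → mem N z e ≡ (if _∈E_ {N = N} z e then 1 else 0)
  mem-∈E z e with _∈E_ {N = N} z e
  ... | true  = refl
  ... | false = refl

  sumAlong-closed-mem : ∀ {c} (p : Path N c c) (e : Edge n m) →
    sumAlong p (λ j → mem N (u j) e) ≡ sumAlong p (λ j → mem N (v j) e)
  sumAlong-closed-mem p (inj₁ s) = begin
      sumAlong p (λ j → mem N (u j) (inj₁ s))  ≡⟨ sumAlong-cong p (λ j → mem-∈E (u j) (inj₁ s)) ⟩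
      sumAlong p (occurs ∘ reactant N)          ≡⟨ sumAlong-closed occurs p ⟩
      sumAlong p (occurs ∘ product N)           ≡⟨ sumAlong-cong p (λ j → sym (mem-∈E (v j) (inj₁ s))) ⟩
      sumAlong p (λ j → mem N (v j) (inj₁ s))  ∎
    where
    open ≡-Reasoning
    occurs : Vec ℕ n → ℕ
    occurs y = if nonzero (lookup y s) then 1 else 0
  sumAlong-closed-mem p (inj₂ i) =
    sumAlong-cong p (λ j → trans (mem-∈E (u j) (inj₂ i)) (sym (mem-∈E (v j) (inj₂ i))))

  sumAlong-closed-deg : ∀ {c} (p : Path N c c) (μ : Edge n m → ℕ) →
    sumAlong p (λ j → deg N μ (u j)) ≡ sumAlong p (λ j → deg N μ (v j))
  sumAlong-closed-deg p μ = begin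
      sumAlong p (λ j → deg N μ (u j))                           ≡⟨ sumAlong-pairing p μ (mem N ∘ u) ⟩
      pairing μ (λ e → sumAlong p (λ j → mem N (u j) e))        ≡⟨ pairing-congʳ μ (sumAlong-closed-mem p) ⟩
      pairing μ (λ e → sumAlong p (λ j → mem N (v j) e))        ≡⟨ sym (sumAlong-pairing p μ (mem N ∘ v)) ⟩
      sumAlong p (λ j → deg N μ (v j))                           ∎
    where open ≡-Reasoning

module _ {m : ℕ} where

  u-injective : ∀ {i j : Fin m} → u i ≡ u j → i ≡ j
  u-injective refl = refl

  v-injective : ∀ {i j : Fin m} → v i ≡ v j → i ≡ j
  v-injective refl = refl

  _≟ᵛ_ : DecidableEquality (Vertex m)
  u i ≟ᵛ u j = map′ (cong u) u-injective (i ≟ j)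
  u i ≟ᵛ v j = no (λ ())
  v i ≟ᵛ u j = no (λ ())
  v i ≟ᵛ v j = map′ (cong v) v-injective (i ≟ j)

  reaction : Vertex m → Fin m
  reaction (u i) = i
  reaction (v i) = i

  side : Vertex m → Fin m → Vertex m
  side (u _) = u
  side (v _) = v

  opposite : Vertex m → Fin m → Vertex m
  opposite (u _) = v
  opposite (v _) = u

  side-reaction : ∀ w → side w (reaction w) ≡ w
  side-reaction (u i) = refl
  side-reaction (v i) = refl

  opposite≢ : ∀ w j → opposite w j ≢ w
  opposite≢ (u i) j ()
  opposite≢ (v i) j ()

module _ {n m : ℕ} {N : Network n m} where

  sumAlong-closed-deg-side : ∀ {c} (p : Path N c c) (μ : Edge n m → ℕ) (w : Vertex m) →
    sumAlong p (λ j → deg N μ (side w j)) ≡ sumAlong p (λ j → deg N μ (opposite w j))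
  sumAlong-closed-deg-side p μ (u i) = sumAlong-closed-deg p μ
  sumAlong-closed-deg-side p μ (v i) = sym (sumAlong-closed-deg p μ)

onCycle⇒¬AlmostBalanced : ∀ {n m} (N : Network n m) (w : Vertex m) →
  Path N (product N (reaction w)) (reactant N (reaction w)) → ¬ AlmostBalanced N w
onCycle⇒¬AlmostBalanced {n} {m} N w back (μr , μb , k , 0<k , degʳw≡degᵇw+k , balanced) =
  <-irrefl same excess
  where
  i = reaction w

  cycle : Path N (reactant N i) (reactant N i)
  cycle = (i , refl , refl) ◅ back

  weighted : (Edge n m → ℕ) → (Fin m → Vertex m) → ℕ
  weighted μ φ = sumAlong cycle (λ j → deg N μ (φ j))

  degᵇ≤degʳ : ∀ z → deg N μb z ≤ deg N μr z
  degᵇ≤degʳ z with z ≟ᵛ w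
  ... | yes refl = subst (deg N μb z ≤_) (sym degʳw≡degᵇw+k) (m≤m+n _ k)
  ... | no  z≢w  = ≤-reflexive (sym (balanced z z≢w))

  degᵇw<degʳw : deg N μb (side w i) < deg N μr (side w i)
  degᵇw<degʳw rewrite side-reaction w = subst (deg N μb w <_) (sym degʳw≡degᵇw+k) (m<m+n _ 0<k)

  excess : weighted μb (side w) < weighted μr (side w)
  excess = sumAlong-<-head (i , refl , refl) back (degᵇ≤degʳ ∘ side w) degᵇw<degʳw

  same : weighted μb (side w) ≡ weighted μr (side w)
  same = begin
      weighted μb (side w)      ≡⟨ sumAlong-closed-deg-side cycle μb w ⟩
      weighted μb (opposite w)  ≡⟨ sumAlong-cong cycle (λ j → sym (balanced (opposite w j) (opposite≢ w j))) ⟩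
      weighted μr (opposite w)  ≡⟨ sym (sumAlong-closed-deg-side cycle μr w) ⟩
      weighted μr (side w)      ∎
    where open ≡-Reasoning

corollary3p11 : ∀ {n m : ℕ} (N : Network n m) → IsCRN N → WeaklyReversible N →
                ∀ (w : Vertex m) → ¬ AlmostBalanced N w
corollary3p11 N _ weaklyReversible w =
  onCycle⇒¬AlmostBalanced N w (weaklyReversible _ _ ((reaction w , refl , refl) ◅ ε))
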